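{- U-sentences are closed under conjunction: if $\phi$ and $\psi$ are U-sentences over a signature $\{R,\vec a\}$, then $\phi\wedge\psi$ is logically equivalent to some U-sentence over $\{R,\vec a\}$.
   Context: Let $R$ be a $k$-ary relation symbol and $\vec a$ a tuple of constant symbols. A U-sentence over $\{R,\vec a\}$ is a first-order sentence of the form $\exists\vec x(\eta(\vec x)\wedge\forall\vec y(R\vec y\to\theta(\vec x,\vec y)))$, where $\vec x,\vec y$ are disjoint tuples of distinct variables, $\eta$ is a conjunction of first-order literals over $\{R,\vec a\}$ in which $R$ occurs only positively, and $\theta$ is a first-order formula over the signature $\{\vec a\}$ (in which $R$ does not occur). -}

module Defs where

open import Data.Nat using (ℕ; zero; suc; _+_)
open import Data.Fin using (Fin; zero; suc; _↑ˡ_; opposite)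
open import Data.Vec using (Vec; tabulate) renaming (map to vmap)
open import Data.List using (List; foldr)
open import Data.Product using (Σ; _×_; _,_)
open import Data.Sum using (_⊎_)
open import Data.Empty using (⊥)
open import Data.Unit using (⊤)
open import Relation.Binary.PropositionalEquality using (_≡_)
open import Function.Bundles using (_⇔_)

-- Signature {R, a⃗}: one k-ary relation symbol R and m constants a₀ … a_{m-1}.
-- First-order logic with equality, well-scoped de Bruijn syntax:
-- Formula k m n = formulas with free variables among Fin n
-- (index zero = innermost bound variable).

data Term (m n : ℕ) : Set where
  var : Fin n → Term m n
  con : Fin m → Term m n

data Formula (k m : ℕ) : ℕ → Set where
  rel  : ∀ {n} → Vec (Term m n) k → Formula k m n
  _≐_  : ∀ {n} → Term m n → Term m n → Formula k m n
  ⊤'   : ∀ {n} → Formula k m n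
  ⊥'   : ∀ {n} → Formula k m n
  ¬'_  : ∀ {n} → Formula k m n → Formula k m n
  _∧'_ : ∀ {n} → Formula k m n → Formula k m n → Formula k m n
  _∨'_ : ∀ {n} → Formula k m n → Formula k m n → Formula k m n
  _⇒'_ : ∀ {n} → Formula k m n → Formula k m n → Formula k m n
  ∀'_  : ∀ {n} → Formula k m (suc n) → Formula k m n
  ∃'_  : ∀ {n} → Formula k m (suc n) → Formula k m n

data RFree {k m : ℕ} : {n : ℕ} → Formula k m n → Set where
  eq  : ∀ {n} (s t : Term m n) → RFree (s ≐ t)
  tt' : ∀ {n} → RFree {n = n} ⊤'
  ff' : ∀ {n} → RFree {n = n} ⊥'
  neg : ∀ {n} {φ : Formula k m n} → RFree φ → RFree (¬' φ)
  and : ∀ {n} {φ ψ : Formula k m n} → RFree φ → RFree ψ → RFree (φ ∧' ψ)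
  or  : ∀ {n} {φ ψ : Formula k m n} → RFree φ → RFree ψ → RFree (φ ∨' ψ)
  imp : ∀ {n} {φ ψ : Formula k m n} → RFree φ → RFree ψ → RFree (φ ⇒' ψ)
  all : ∀ {n} {φ : Formula k m (suc n)} → RFree φ → RFree (∀' φ)
  ex  : ∀ {n} {φ : Formula k m (suc n)} → RFree φ → RFree (∃' φ)

-- Literals in which R occurs only positively: R t⃗, s = t, ¬ s = t.
data Literal (k m n : ℕ) : Set where
  relLit : Vec (Term m n) k → Literal k m n
  eqLit  : Term m n → Term m n → Literal k m n
  neqLit : Term m n → Term m n → Literal k m n

litFormula : ∀ {k m n} → Literal k m n → Formula k m n
litFormula (relLit ts) = rel ts
litFormula (eqLit s t) = s ≐ t
litFormula (neqLit s t) = ¬' (s ≐ t)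

conj : ∀ {k m n} → List (Literal k m n) → Formula k m n
conj = foldr (λ l φ → litFormula l ∧' φ) ⊤'

∃*_ : ∀ {k m n} (p : ℕ) → Formula k m (p + n) → Formula k m n
∃*_ zero φ = φ
∃*_ (suc p) φ = ∃*_ p (∃' φ)

∀*_ : ∀ {k m n} (p : ℕ) → Formula k m (p + n) → Formula k m n
∀*_ zero φ = φ
∀*_ (suc p) φ = ∀*_ p (∀' φ)

-- The tuple y⃗ = (y₁,…,y_k) bound by ∀y₁…∀y_k (y₁ outermost, so y_{i+1}
-- has de Bruijn index k-1-i), inside the scope of x₁…x_p.
yTuple : ∀ {m} (k p : ℕ) → Vec (Term m (k + p)) k
yTuple k p = tabulate (λ i → var (opposite i ↑ˡ p))

-- The U-sentence  ∃x⃗ (η(x⃗) ∧ ∀y⃗ (R y⃗ → θ(x⃗,y⃗)))  with |x⃗| = p.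
USent : ∀ {k m} (p : ℕ) → List (Literal k m (p + 0)) →
        Formula k m (k + (p + 0)) → Formula k m 0
USent {k} p η θ = ∃*_ p (conj η ∧' ∀*_ k (rel (yTuple k (p + 0)) ⇒' θ))

IsUSentence : ∀ {k m} → Formula k m 0 → Set
IsUSentence {k} {m} φ =
  Σ ℕ λ p → Σ (List (Literal k m (p + 0))) λ η →
  Σ (Formula k m (k + (p + 0))) λ θ → RFree θ × (φ ≡ USent p η θ)

record Structure (k m : ℕ) : Set₁ where
  field
    Carrier : Set
    inhabitant : Carrier
    const : Fin m → Carrier
    R : Vec Carrier k → Set

open Structure public

extend : ∀ {A : Set} {n} → A → (Fin n → A) → Fin (suc n) → A
extend a ρ zero = a
extend a ρ (suc i) = ρ i

evalTerm : ∀ {k m n} (M : Structure k m) → (Fin n → Carrier M) → Term m n → Carrier M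
evalTerm M ρ (var i) = ρ i
evalTerm M ρ (con c) = const M c

Sat : ∀ {k m n} (M : Structure k m) → (Fin n → Carrier M) → Formula k m n → Set
Sat M ρ (rel ts) = R M (vmap (evalTerm M ρ) ts)
Sat M ρ (s ≐ t) = evalTerm M ρ s ≡ evalTerm M ρ t
Sat M ρ ⊤' = ⊤
Sat M ρ ⊥' = ⊥
Sat M ρ (¬' φ) = Sat M ρ φ → ⊥
Sat M ρ (φ ∧' ψ) = Sat M ρ φ × Sat M ρ ψ
Sat M ρ (φ ∨' ψ) = Sat M ρ φ ⊎ Sat M ρ ψ
Sat M ρ (φ ⇒' ψ) = Sat M ρ φ → Sat M ρ ψ
Sat M ρ (∀' φ) = (a : Carrier M) → Sat M (extend a ρ) φ
Sat M ρ (∃' φ) = Σ (Carrier M) λ a → Sat M (extend a ρ) φ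

LogEquiv : ∀ {k m n} → Formula k m n → Formula k m n → Set₁
LogEquiv {k} {m} {n} φ ψ =
  (M : Structure k m) (ρ : Fin n → Carrier M) → Sat M ρ φ ⇔ Sat M ρ ψ

{-# OPTIONS --safe #-}
-- Rename the existential variables of the two sentences apart, placing those of the first
-- before those of the second. Then ∃x⃗(η₁ ∧ ∀y⃗(R y⃗ → θ₁)) ∧ ∃u⃗(η₂ ∧ ∀y⃗(R y⃗ → θ₂)) is
-- equivalent to ∃x⃗u⃗((η₁ ∧ η₂) ∧ ∀y⃗(R y⃗ → θ₁ ∧ θ₂)): a witness x⃗u⃗ of the combined sentence
-- splits into witnesses of the two conjuncts and conversely, and ∀ distributes over ∧. The
-- result is again a U-sentence, since η₁ ++ η₂ is a list of literals and θ₁ ∧ θ₂ is R-free.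
module Submission where

open import Defs
open import Data.Nat using (ℕ; zero; suc; _+_)
open import Data.Product using (Σ; _×_; _,_; proj₁; proj₂)
open import Data.Product.Function.NonDependent.Propositional using (_×-cong_)
import Data.Product.Function.Dependent.Propositional as Σ
open import Data.Sum.Function.Propositional using (_⊎-cong_)
open import Data.Fin using (Fin; zero; suc; _↑ˡ_; _↑ʳ_; opposite)
open import Data.Vec using (tabulate) renaming (map to vmap)
open import Data.Vec.Properties using (map-∘; map-cong; tabulate-∘; tabulate-cong)
open import Data.List using (List; []; _∷_; _++_) renaming (map to lmap)
open import Data.Unit using (tt)
open import Function using (_∘_; _⇔_; mk⇔; Equivalence)
open import Function.Related.Propositional using (≡⇒; K-refl; module EquationalReasoning)
open import Function.Related.TypeIsomorphisms using (→-cong-⇔; ¬-cong-⇔)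
open import Relation.Binary.PropositionalEquality using (_≡_; refl; cong; cong₂; module ≡-Reasoning)

open Equivalence

private
  variable
    k m n n' p q : ℕ
    A : Set

Π-cong-⇔ : {P Q : A → Set} → (∀ a → P a ⇔ Q a) → ((a : A) → P a) ⇔ ((a : A) → Q a)
Π-cong-⇔ P⇔Q = mk⇔ (λ f a → to (P⇔Q a) (f a)) (λ g a → from (P⇔Q a) (g a))

Ren : ℕ → ℕ → Set
Ren n n' = Fin n → Fin n'

liftRen : Ren n n' → Ren (suc n) (suc n')
liftRen r zero = zero
liftRen r (suc i) = suc (r i)

liftRen* : ∀ j → Ren n n' → Ren (j + n) (j + n')
liftRen* zero r = r
liftRen* (suc j) r = liftRen (liftRen* j r)

renameTerm : Ren n n' → Term m n → Term m n'
renameTerm r (var i) = var (r i)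
renameTerm r (con c) = con c

rename : Ren n n' → Formula k m n → Formula k m n'
rename r (rel ts) = rel (vmap (renameTerm r) ts)
rename r (s ≐ t) = renameTerm r s ≐ renameTerm r t
rename r ⊤' = ⊤'
rename r ⊥' = ⊥'
rename r (¬' φ) = ¬' rename r φ
rename r (φ ∧' ψ) = rename r φ ∧' rename r ψ
rename r (φ ∨' ψ) = rename r φ ∨' rename r ψ
rename r (φ ⇒' ψ) = rename r φ ⇒' rename r ψ
rename r (∀' φ) = ∀' rename (liftRen r) φ
rename r (∃' φ) = ∃' rename (liftRen r) φ

renameLiteral : Ren n n' → Literal k m n → Literal k m n'
renameLiteral r (relLit ts) = relLit (vmap (renameTerm r) ts)
renameLiteral r (eqLit s t) = eqLit (renameTerm r s) (renameTerm r t)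
renameLiteral r (neqLit s t) = neqLit (renameTerm r s) (renameTerm r t)

rename-RFree : (r : Ren n n') {φ : Formula k m n} → RFree φ → RFree (rename r φ)
rename-RFree r (eq s t) = eq _ _
rename-RFree r tt' = tt'
rename-RFree r ff' = ff'
rename-RFree r (neg φ) = neg (rename-RFree r φ)
rename-RFree r (and φ ψ) = and (rename-RFree r φ) (rename-RFree r ψ)
rename-RFree r (or φ ψ) = or (rename-RFree r φ) (rename-RFree r ψ)
rename-RFree r (imp φ ψ) = imp (rename-RFree r φ) (rename-RFree r ψ)
rename-RFree r (all φ) = all (rename-RFree (liftRen r) φ)
rename-RFree r (ex φ) = ex (rename-RFree (liftRen r) φ)

litFormula-rename : (r : Ren n n') (l : Literal k m n) →
  litFormula (renameLiteral r l) ≡ rename r (litFormula l)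
litFormula-rename r (relLit ts) = refl
litFormula-rename r (eqLit s t) = refl
litFormula-rename r (neqLit s t) = refl

conj-rename : (r : Ren n n') (η : List (Literal k m n)) →
  conj (lmap (renameLiteral r) η) ≡ rename r (conj η)
conj-rename r [] = refl
conj-rename r (l ∷ η) = cong₂ _∧'_ (litFormula-rename r l) (conj-rename r η)

-- σ ++ᵉ ρ assigns σ to the p innermost variables, matching the binding order of ∃*_ p and ∀*_ p.
infixr 5 _++ᵉ_
_++ᵉ_ : (Fin p → A) → (Fin n → A) → Fin (p + n) → A
_++ᵉ_ {p = zero} σ ρ = ρ
_++ᵉ_ {p = suc p} σ ρ = extend (σ zero) ((σ ∘ suc) ++ᵉ ρ)

++ᵉ-↑ˡ : (σ : Fin p → A) (ρ : Fin n → A) (i : Fin p) → (σ ++ᵉ ρ) (i ↑ˡ n) ≡ σ i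
++ᵉ-↑ˡ σ ρ zero = refl
++ᵉ-↑ˡ σ ρ (suc i) = ++ᵉ-↑ˡ (σ ∘ suc) ρ i

++ᵉ-↑ʳ : (σ : Fin p → A) (ρ : Fin n → A) (i : Fin n) → (σ ++ᵉ ρ) (p ↑ʳ i) ≡ ρ i
++ᵉ-↑ʳ {p = zero} σ ρ i = refl
++ᵉ-↑ʳ {p = suc p} σ ρ i = ++ᵉ-↑ʳ (σ ∘ suc) ρ i

++ᵉ-congˡ : {σ σ' : Fin p → A} (ρ : Fin n → A) → (∀ i → σ i ≡ σ' i) →
  ∀ i → (σ ++ᵉ ρ) i ≡ (σ' ++ᵉ ρ) i
++ᵉ-congˡ {p = zero} ρ σ≗σ' i = refl
++ᵉ-congˡ {p = suc p} ρ σ≗σ' zero = σ≗σ' zero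
++ᵉ-congˡ {p = suc p} ρ σ≗σ' (suc i) = ++ᵉ-congˡ ρ (σ≗σ' ∘ suc) i

liftRen*-agree : ∀ j (r : Ren n n') {ρ' : Fin n' → A} {ρ : Fin n → A} → (∀ i → ρ' (r i) ≡ ρ i) →
  (τ : Fin j → A) → ∀ i → (τ ++ᵉ ρ') (liftRen* j r i) ≡ (τ ++ᵉ ρ) i
liftRen*-agree zero r agree τ i = agree i
liftRen*-agree (suc j) r agree τ zero = refl
liftRen*-agree (suc j) r agree τ (suc i) = liftRen*-agree j r agree (τ ∘ suc) i

leftBlock : ∀ p q → Ren (p + n) ((p + q) + n)
leftBlock zero q i = q ↑ʳ i
leftBlock (suc p) q zero = zero
leftBlock (suc p) q (suc i) = suc (leftBlock p q i)

rightBlock : ∀ p q → Ren (q + n) ((p + q) + n)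
rightBlock zero q i = i
rightBlock (suc p) q i = suc (rightBlock p q i)

leftBlock-agree : {σ : Fin (p + q) → A} {σ₁ : Fin p → A} (ρ : Fin n → A) →
  (∀ i → σ (i ↑ˡ q) ≡ σ₁ i) → ∀ i → (σ ++ᵉ ρ) (leftBlock p q i) ≡ (σ₁ ++ᵉ ρ) i
leftBlock-agree {p = zero} {σ = σ} ρ _ i = ++ᵉ-↑ʳ σ ρ i
leftBlock-agree {p = suc p} ρ agree zero = agree zero
leftBlock-agree {p = suc p} ρ agree (suc i) = leftBlock-agree ρ (agree ∘ suc) i

rightBlock-agree : {σ : Fin (p + q) → A} {σ₂ : Fin q → A} (ρ : Fin n → A) →
  (∀ i → σ (p ↑ʳ i) ≡ σ₂ i) → ∀ i → (σ ++ᵉ ρ) (rightBlock p q i) ≡ (σ₂ ++ᵉ ρ) i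
rightBlock-agree {p = zero} ρ agree i = ++ᵉ-congˡ ρ agree i
rightBlock-agree {p = suc p} {σ = σ} ρ agree i = rightBlock-agree {σ = σ ∘ suc} ρ agree i

mergeLiterals : ∀ {k m n} p q → List (Literal k m (p + n)) → List (Literal k m (q + n)) →
  List (Literal k m ((p + q) + n))
mergeLiterals p q η₁ η₂ =
  lmap (renameLiteral (leftBlock p q)) η₁ ++ lmap (renameLiteral (rightBlock p q)) η₂

mergeBody : ∀ {k m n} p q → Formula k m (k + (p + n)) → Formula k m (k + (q + n)) →
  Formula k m (k + ((p + q) + n))
mergeBody {k} p q θ₁ θ₂ =
  rename (liftRen* k (leftBlock p q)) θ₁ ∧' rename (liftRen* k (rightBlock p q)) θ₂

×-Π-interchange : {P₁ P₂ : Set} {B C₁ C₂ : A → Set} →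
  ((P₁ × P₂) × (∀ a → B a → C₁ a × C₂ a)) ⇔
  ((P₁ × (∀ a → B a → C₁ a)) × (P₂ × (∀ a → B a → C₂ a)))
×-Π-interchange = mk⇔
  (λ ((x₁ , x₂) , f) → (x₁ , λ a b → proj₁ (f a b)) , (x₂ , λ a b → proj₂ (f a b)))
  (λ ((x₁ , f₁) , (x₂ , f₂)) → (x₁ , x₂) , λ a b → f₁ a b , f₂ a b)

module Semantics (M : Structure k m) where

  evalTerm-rename : (r : Ren n n') {ρ' : Fin n' → Carrier M} {ρ : Fin n → Carrier M} →
    (∀ i → ρ' (r i) ≡ ρ i) → ∀ t → evalTerm M ρ' (renameTerm r t) ≡ evalTerm M ρ t
  evalTerm-rename r agree (var i) = agree i
  evalTerm-rename r agree (con c) = refl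

  extend-agree : (r : Ren n n') {ρ' : Fin n' → Carrier M} {ρ : Fin n → Carrier M} →
    (∀ i → ρ' (r i) ≡ ρ i) → ∀ a i → extend a ρ' (liftRen r i) ≡ extend a ρ i
  extend-agree r agree a zero = refl
  extend-agree r agree a (suc i) = agree i

  Sat-rename : (r : Ren n n') {ρ' : Fin n' → Carrier M} {ρ : Fin n → Carrier M} →
    (∀ i → ρ' (r i) ≡ ρ i) → (φ : Formula k m n) → Sat M ρ' (rename r φ) ⇔ Sat M ρ φ
  Sat-rename r agree (rel ts) = ≡⇒ (cong (R M) (begin
      vmap (evalTerm M _) (vmap (renameTerm r) ts) ≡⟨ map-∘ _ _ ts ⟨
      vmap (evalTerm M _ ∘ renameTerm r) ts         ≡⟨ map-cong (evalTerm-rename r agree) ts ⟩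
      vmap (evalTerm M _) ts                         ∎))
    where open ≡-Reasoning
  Sat-rename r agree (s ≐ t) = ≡⇒ (cong₂ _≡_ (evalTerm-rename r agree s) (evalTerm-rename r agree t))
  Sat-rename r agree ⊤' = K-refl
  Sat-rename r agree ⊥' = K-refl
  Sat-rename r agree (¬' φ) = ¬-cong-⇔ (Sat-rename r agree φ)
  Sat-rename r agree (φ ∧' ψ) = Sat-rename r agree φ ×-cong Sat-rename r agree ψ
  Sat-rename r agree (φ ∨' ψ) = Sat-rename r agree φ ⊎-cong Sat-rename r agree ψ
  Sat-rename r agree (φ ⇒' ψ) = →-cong-⇔ (Sat-rename r agree φ) (Sat-rename r agree ψ)
  Sat-rename r agree (∀' φ) = Π-cong-⇔ λ a → Sat-rename (liftRen r) (extend-agree r agree a) φ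
  Sat-rename r agree (∃' φ) = Σ.congˡ λ {a} → Sat-rename (liftRen r) (extend-agree r agree a) φ

  Sat-conj-++ : (ρ : Fin n → Carrier M) (η₁ η₂ : List (Literal k m n)) →
    Sat M ρ (conj (η₁ ++ η₂)) ⇔ (Sat M ρ (conj η₁) × Sat M ρ (conj η₂))
  Sat-conj-++ ρ [] η₂ = mk⇔ (tt ,_) proj₂
  Sat-conj-++ ρ (l ∷ η₁) η₂ = mk⇔
    (λ (x , xs) → let (ys , zs) = to (Sat-conj-++ ρ η₁ η₂) xs in (x , ys) , zs)
    (λ ((x , ys) , zs) → x , from (Sat-conj-++ ρ η₁ η₂) (ys , zs))

  Sat-conj-rename : (r : Ren n n') {ρ' : Fin n' → Carrier M} {ρ : Fin n → Carrier M} →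
    (∀ i → ρ' (r i) ≡ ρ i) → (η : List (Literal k m n)) →
    Sat M ρ' (conj (lmap (renameLiteral r) η)) ⇔ Sat M ρ (conj η)
  Sat-conj-rename r agree η rewrite conj-rename r η = Sat-rename r agree (conj η)

  Sat-∃* : ∀ p (ρ : Fin n → Carrier M) (φ : Formula k m (p + n)) →
    Sat M ρ (∃*_ p φ) ⇔ Σ (Fin p → Carrier M) (λ σ → Sat M (σ ++ᵉ ρ) φ)
  Sat-∃* zero ρ φ = mk⇔ (λ x → (λ ()) , x) proj₂
  Sat-∃* (suc p) ρ φ = mk⇔
    (λ x → let (σ , a , y) = to (Sat-∃* p ρ (∃' φ)) x in extend a σ , y)
    (λ (σ , y) → from (Sat-∃* p ρ (∃' φ)) (σ ∘ suc , σ zero , y))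

  Sat-∀* : ∀ p (ρ : Fin n → Carrier M) (φ : Formula k m (p + n)) →
    Sat M ρ (∀*_ p φ) ⇔ ((σ : Fin p → Carrier M) → Sat M (σ ++ᵉ ρ) φ)
  Sat-∀* zero ρ φ = mk⇔ (λ x _ → x) (λ f → f (λ ()))
  Sat-∀* (suc p) ρ φ = mk⇔
    (λ x σ → to (Sat-∀* p ρ (∀' φ)) x (σ ∘ suc) (σ zero))
    (λ f → from (Sat-∀* p ρ (∀' φ)) (λ σ a → f (extend a σ)))

  yTuple-eval : (τ : Fin k → Carrier M) (ρ : Fin n → Carrier M) →
    vmap (evalTerm M (τ ++ᵉ ρ)) (yTuple k n) ≡ tabulate (τ ∘ opposite)
  yTuple-eval τ ρ = begin
      vmap (evalTerm M (τ ++ᵉ ρ)) (tabulate (λ i → var (opposite i ↑ˡ _))) ≡⟨ tabulate-∘ _ _ ⟨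
      tabulate (λ i → (τ ++ᵉ ρ) (opposite i ↑ˡ _))                         ≡⟨ tabulate-cong (++ᵉ-↑ˡ τ ρ ∘ opposite) ⟩
      tabulate (τ ∘ opposite)                                               ∎
    where open ≡-Reasoning

  -- The matrix η(x⃗) ∧ ∀y⃗(R y⃗ → θ) at x⃗ := σ, with R y⃗ read off τ directly so that it does not
  -- depend on the number of x⃗'s, unlike R (yTuple k (p + n)).
  USentMatrix : (ρ : Fin n → Carrier M) (η : List (Literal k m (p + n))) (θ : Formula k m (k + (p + n))) →
    (Fin p → Carrier M) → Set
  USentMatrix ρ η θ σ = Sat M (σ ++ᵉ ρ) (conj η) ×
    ((τ : Fin k → Carrier M) → R M (tabulate (τ ∘ opposite)) → Sat M (τ ++ᵉ σ ++ᵉ ρ) θ)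

  Sat-USent : (ρ : Fin 0 → Carrier M) (η : List (Literal k m (p + 0))) (θ : Formula k m (k + (p + 0))) →
    Sat M ρ (USent p η θ) ⇔ Σ (Fin p → Carrier M) (USentMatrix ρ η θ)
  Sat-USent {p = p} ρ η θ = begin
      Sat M ρ (USent p η θ)
    ∼⟨ Sat-∃* p ρ _ ⟩
      Σ (Fin p → Carrier M) (λ σ → Sat M (σ ++ᵉ ρ) (conj η ∧' ∀*_ k (rel (yTuple k (p + 0)) ⇒' θ)))
    ∼⟨ Σ.congˡ (λ {σ} → K-refl ×-cong Sat-∀* k (σ ++ᵉ ρ) _) ⟩
      Σ (Fin p → Carrier M) (λ σ → Sat M (σ ++ᵉ ρ) (conj η) × ((τ : Fin k → Carrier M) →
        R M (vmap (evalTerm M (τ ++ᵉ σ ++ᵉ ρ)) (yTuple k (p + 0))) → Sat M (τ ++ᵉ σ ++ᵉ ρ) θ))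
    ∼⟨ Σ.congˡ (λ {σ} → K-refl ×-cong Π-cong-⇔ λ τ →
         →-cong-⇔ (≡⇒ (cong (R M) (yTuple-eval τ (σ ++ᵉ ρ)))) K-refl) ⟩
      Σ (Fin p → Carrier M) (USentMatrix ρ η θ)
    ∎
    where open EquationalReasoning

  USentMatrix-merge : (ρ : Fin n → Carrier M)
    (η₁ : List (Literal k m (p + n))) (θ₁ : Formula k m (k + (p + n)))
    (η₂ : List (Literal k m (q + n))) (θ₂ : Formula k m (k + (q + n)))
    {σ : Fin (p + q) → Carrier M} {σ₁ : Fin p → Carrier M} {σ₂ : Fin q → Carrier M} →
    (∀ i → σ (i ↑ˡ q) ≡ σ₁ i) → (∀ i → σ (p ↑ʳ i) ≡ σ₂ i) →
    USentMatrix ρ (mergeLiterals p q η₁ η₂) (mergeBody p q θ₁ θ₂) σ ⇔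
    (USentMatrix ρ η₁ θ₁ σ₁ × USentMatrix ρ η₂ θ₂ σ₂)
  USentMatrix-merge {p = p} {q} ρ η₁ θ₁ η₂ θ₂ {σ} {σ₁} {σ₂} σ≗σ₁ σ≗σ₂ = begin
      USentMatrix ρ (mergeLiterals p q η₁ η₂) (mergeBody p q θ₁ θ₂) σ
    ∼⟨ Sat-conj-++ (σ ++ᵉ ρ) η₁′ η₂′ ×-cong K-refl ⟩
      ((Sat M (σ ++ᵉ ρ) (conj η₁′) × Sat M (σ ++ᵉ ρ) (conj η₂′)) ×
       ((τ : Fin k → Carrier M) → R M (tabulate (τ ∘ opposite)) →
         Sat M (τ ++ᵉ σ ++ᵉ ρ) (mergeBody p q θ₁ θ₂)))
    ∼⟨ (Sat-conj-rename (leftBlock p q) agree₁ η₁ ×-cong Sat-conj-rename (rightBlock p q) agree₂ η₂)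
         ×-cong Π-cong-⇔ (λ τ → →-cong-⇔ K-refl
           (Sat-rename _ (liftRen*-agree k _ agree₁ τ) θ₁ ×-cong
            Sat-rename _ (liftRen*-agree k _ agree₂ τ) θ₂)) ⟩
      ((Sat M (σ₁ ++ᵉ ρ) (conj η₁) × Sat M (σ₂ ++ᵉ ρ) (conj η₂)) ×
       ((τ : Fin k → Carrier M) → R M (tabulate (τ ∘ opposite)) →
         Sat M (τ ++ᵉ σ₁ ++ᵉ ρ) θ₁ × Sat M (τ ++ᵉ σ₂ ++ᵉ ρ) θ₂))
    ∼⟨ ×-Π-interchange ⟩
      (USentMatrix ρ η₁ θ₁ σ₁ × USentMatrix ρ η₂ θ₂ σ₂)
    ∎
    where
    open EquationalReasoning
    agree₁ = leftBlock-agree ρ σ≗σ₁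
    agree₂ = rightBlock-agree {p = p} ρ σ≗σ₂
    η₁′ = lmap (renameLiteral (leftBlock p q)) η₁
    η₂′ = lmap (renameLiteral (rightBlock p q)) η₂

  Sat-USent-∧ : (ρ : Fin 0 → Carrier M)
    (η₁ : List (Literal k m (p + 0))) (θ₁ : Formula k m (k + (p + 0)))
    (η₂ : List (Literal k m (q + 0))) (θ₂ : Formula k m (k + (q + 0))) →
    Sat M ρ (USent p η₁ θ₁ ∧' USent q η₂ θ₂) ⇔
    Sat M ρ (USent (p + q) (mergeLiterals p q η₁ η₂) (mergeBody p q θ₁ θ₂))
  Sat-USent-∧ {p = p} {q = q} ρ η₁ θ₁ η₂ θ₂ = mk⇔
    (λ (φ₁ , φ₂) →
      let (σ₁ , w₁) = to (Sat-USent ρ η₁ θ₁) φ₁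
          (σ₂ , w₂) = to (Sat-USent ρ η₂ θ₂) φ₂
      in from (Sat-USent ρ η θ)
           (σ₁ ++ᵉ σ₂ , from (merge (++ᵉ-↑ˡ σ₁ σ₂) (++ᵉ-↑ʳ {p = p} σ₁ σ₂)) (w₁ , w₂)))
    (λ χ →
      let (σ , w) = to (Sat-USent ρ η θ) χ
          (w₁ , w₂) = to (merge (λ _ → refl) (λ _ → refl)) w
      in from (Sat-USent ρ η₁ θ₁) (_ , w₁) , from (Sat-USent ρ η₂ θ₂) (_ , w₂))
    where
    η = mergeLiterals p q η₁ η₂
    θ = mergeBody p q θ₁ θ₂
    merge = USentMatrix-merge ρ η₁ θ₁ η₂ θ₂

proposition10 : (k m : ℕ) (φ ψ : Formula k m 0) →
    IsUSentence φ → IsUSentence ψ →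
    Σ (Formula k m 0) (λ χ → IsUSentence χ × LogEquiv (φ ∧' ψ) χ)
proposition10 k m _ _ (p , η₁ , θ₁ , θ₁-free , refl) (q , η₂ , θ₂ , θ₂-free , refl) =
  USent (p + q) (mergeLiterals p q η₁ η₂) (mergeBody p q θ₁ θ₂) ,
  (p + q , mergeLiterals p q η₁ η₂ , mergeBody p q θ₁ θ₂ ,
   and (rename-RFree _ θ₁-free) (rename-RFree _ θ₂-free) , refl) ,
  λ M ρ → Semantics.Sat-USent-∧ M ρ η₁ θ₁ η₂ θ₂
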